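{- Let $r,n,t$ be positive integers with $n\geq 2$ and $\gcd(nr,t)=1$. Let $\Gamma=(V,E)$ have vertex set $V=V_1\sqcup V_2$ with $V_1=\mathbb{Z}_{rn}$, $V_2=\mathbb{Z}_t$, and edge set $E=E_0\cup E_1$ where $E_0=\{e_{k,j}\mid k\in V_1,j\in V_2\}$ with $e_{k,j}$ joining $k$ and $j$, and $E_1=\{e_k^j\mid k\in V_1, j\in V_2\}$ with $e_k^j$ joining $k$ and $k+r$ (in $\mathbb{Z}_{rn}$). Define $g$ on $V\cup E$ by $k\mapsto k+1$ (in $\mathbb{Z}_{rn}$), $j\mapsto j+1$ (in $\mathbb{Z}_t$), $e_{k,j}\mapsto e_{k+1,j+1}$, $e_k^j\mapsto e_{k+1}^{j+1}$. Then $\Gamma$ is connected, $g\in\mathrm{Aut}\,\Gamma$, and $\langle g\rangle\cong\mathbb{Z}_{rnt}$ has exactly two orbits $V_1,V_2$ on $V$ and is bi-regular on $E$ with orbits $E_0,E_1$. Moreover the edge-induced subgraph $[E_0]$ is $\mathbf{K}_{rn,t}$, and $[E_1]$ is $r\mathbf{K}_2^{(2t)}$ if $n=2$ and $r\mathbf{C}_n^{(t)}$ if $n\geq 3$.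
   Context: Graphs are finite, loopless, possibly with multiple edges; automorphisms permute $V\cup E$ preserving $V$, $E$ and incidence. Bi-regular on $E$: the induced permutation group on $E$ has exactly two orbits and order $|E|/2$. $[E']$ is the subgraph formed by the edges in $E'$ and their incident vertices. $\Gamma^{(\lambda)}$ replaces each edge by $\lambda$ parallel edges; $r\Sigma$ is a disjoint union of $r$ copies of $\Sigma$; $\mathbf{C}_n$ simple $n$-cycle; $\mathbf{K}_{s,t}$ simple complete bipartite. -}

module Defs where

open import Data.Nat using (ℕ; zero; suc; _+_; _*_; _<_; _≤_)
open import Data.Nat.DivMod using (_mod_)
open import Data.Nat.GeneralisedArithmetic using (iterate)
open import Data.Fin using (Fin; toℕ)
open import Data.Product using (Σ; ∃; ∃-syntax; _×_; _,_; proj₁; proj₂)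
open import Data.Sum using (_⊎_; inj₁; inj₂)
open import Data.Unit using (⊤; tt)
open import Data.Empty using (⊥)
open import Relation.Nullary using (¬_)
open import Relation.Binary.PropositionalEquality using (_≡_)
open import Relation.Binary.Construct.Closure.ReflexiveTransitive using (Star)
open import Function.Definitions using (Bijective; Injective)
open import Function.Bundles using (_⇔_)

-- Finite multigraphs (loops not needed here).  An edge has an (ordered
-- for bookkeeping) pair of end vertices; incidence is "v is one of the ends".

record Graph : Set₁ where
  field
    Vtx  : Set
    Edge : Set
    ends : Edge → Vtx × Vtx

open Graph public

Incident : (G : Graph) → Edge G → Vtx G → Set
Incident G e v = (v ≡ proj₁ (ends G e)) ⊎ (v ≡ proj₂ (ends G e))

Adjacent : (G : Graph) → Vtx G → Vtx G → Set
Adjacent G u w = ∃[ e ] ((ends G e ≡ (u , w)) ⊎ (ends G e ≡ (w , u)))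

Connected : Graph → Set
Connected G = ∀ u v → Star (Adjacent G) u v

IsAut : (G : Graph) → (Vtx G → Vtx G) → (Edge G → Edge G) → Set
IsAut G fV fE =
  Bijective _≡_ _≡_ fV × Bijective _≡_ _≡_ fE ×
  (∀ e v → Incident G e v ⇔ Incident G (fE e) (fV v))

PowId : {A : Set} → (A → A) → ℕ → Set
PowId f k = ∀ x → iterate f x k ≡ x

HasOrder : {A : Set} → (A → A) → ℕ → Set
HasOrder f m = PowId f m × (∀ k → 0 < k → k < m → ¬ PowId f k)

HasOrder₂ : {A B : Set} → (A → A) → (B → B) → ℕ → Set
HasOrder₂ fV fE m =
  (PowId fV m × PowId fE m) × (∀ k → 0 < k → k < m → ¬ (PowId fV k × PowId fE k))

-- y lies in the ⟨f⟩-orbit of x (f a permutation of a finite set,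
-- so non-negative powers suffice)
Orbit : {A : Set} → (A → A) → A → A → Set
Orbit f x y = ∃[ k ] iterate f x k ≡ y

SumOrbits : {A B : Set} → (A ⊎ B → A ⊎ B) → Set
SumOrbits {A} {B} f =
  (∀ (a a' : A) → Orbit f (inj₁ a) (inj₁ a')) ×
  (∀ (b b' : B) → Orbit f (inj₂ b) (inj₂ b')) ×
  (∀ (a : A) (b : B) → ¬ Orbit f (inj₁ a) (inj₂ b)) ×
  (∀ (a : A) (b : B) → ¬ Orbit f (inj₂ b) (inj₁ a))

-- the induced group ⟨f⟩ on E has exactly two orbits (the two summands)
-- and order |E|/2 (given as the argument `half`)
BiRegular : {A B : Set} → (A ⊎ B → A ⊎ B) → ℕ → Set
BiRegular f half = SumOrbits f × HasOrder f half

-- Edge-induced subgraph [E'] for an edge set E' ⊆ E (given by a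
-- proposition-valued predicate), and "[E'] ≅ H" written out: a vertex
-- bijection from H onto the vertices of [E'] (those incident to an E'-edge)
-- and an edge bijection from H onto E', preserving incidence.

InducedIso : (G : Graph) → (Edge G → Set) → (H : Graph) → Set
InducedIso G P H =
  Σ (Vtx H → Vtx G) λ φV →
  Σ (Edge H → Σ (Edge G) P) λ φE →
    Injective _≡_ _≡_ φV ×
    (∀ v → (∃[ e ] (P e × Incident G e v)) ⇔ (∃[ w ] φV w ≡ v)) ×
    Bijective _≡_ _≡_ φE ×
    (∀ e w → Incident H e w ⇔ Incident G (proj₁ (φE e)) (φV w))

-- addition of k in ℤ_m, with ℤ_m represented by Fin m
shift : {m : ℕ} → ℕ → Fin m → Fin m
shift {suc m} k i = (toℕ i + k) mod (suc m)

Kbip : ℕ → ℕ → Graph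
Kbip s t = record { Vtx = Fin s ⊎ Fin t ; Edge = Fin s × Fin t
                  ; ends = λ { (i , j) → (inj₁ i , inj₂ j) } }

K2 : Graph
K2 = record { Vtx = Fin 2 ; Edge = ⊤ ; ends = λ _ → (Fin.zero , Fin.suc Fin.zero) }

-- simple n-cycle C_n (meaningful for n ≥ 3): vertices ℤ_n, edges i — i+1
Cycle : ℕ → Graph
Cycle n = record { Vtx = Fin n ; Edge = Fin n ; ends = λ i → (i , shift 1 i) }

-- Γ^(λ): each edge replaced by λ parallel edges
mult : ℕ → Graph → Graph
mult l G = record { Vtx = Vtx G ; Edge = Edge G × Fin l
                  ; ends = λ { (e , _) → ends G e } }

-- r Σ: disjoint union of r copies
copies : ℕ → Graph → Graph
copies r G = record { Vtx = Fin r × Vtx G ; Edge = Fin r × Edge G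
                    ; ends = λ { (i , e) → ((i , proj₁ (ends G e)) , (i , proj₂ (ends G e))) } }

-- The graph Γ of Lemma 4.11
-- V = V₁ ⊔ V₂ with V₁ = ℤ_{rn}, V₂ = ℤ_t;
-- E = E₀ ⊔ E₁, E₀ ∋ e_{k,j} = inj₁ (k , j) joining k and j,
--             E₁ ∋ e_k^j  = inj₂ (k , j) joining k and k + r.

GV : ℕ → ℕ → ℕ → Set
GV r n t = Fin (r * n) ⊎ Fin t

GE : ℕ → ℕ → ℕ → Set
GE r n t = (Fin (r * n) × Fin t) ⊎ (Fin (r * n) × Fin t)

Γ : ℕ → ℕ → ℕ → Graph
Γ r n t = record { Vtx = GV r n t ; Edge = GE r n t ; ends = en }
  where
  en : GE r n t → GV r n t × GV r n t
  en (inj₁ (k , j)) = (inj₁ k , inj₂ j)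
  en (inj₂ (k , j)) = (inj₁ k , inj₁ (shift r k))

InE₀ : (r n t : ℕ) → GE r n t → Set
InE₀ r n t (inj₁ _) = ⊤
InE₀ r n t (inj₂ _) = ⊥

InE₁ : (r n t : ℕ) → GE r n t → Set
InE₁ r n t (inj₁ _) = ⊥
InE₁ r n t (inj₂ _) = ⊤

gV : (r n t : ℕ) → GV r n t → GV r n t
gV r n t (inj₁ k) = inj₁ (shift 1 k)
gV r n t (inj₂ j) = inj₂ (shift 1 j)

gE : (r n t : ℕ) → GE r n t → GE r n t
gE r n t (inj₁ (k , j)) = inj₁ (shift 1 k , shift 1 j)
gE r n t (inj₂ (k , j)) = inj₂ (shift 1 k , shift 1 j)

module Submission where

-- g acts by k ↦ k + 1 on both ℤ_{rn} and ℤ_t, hence diagonally on V₁, V₂ and on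
-- E₀ ≅ E₁ ≅ ℤ_{rn} × ℤ_t.  A power g^k is trivial iff rn ∣ k and t ∣ k, so coprimality
-- gives ⟨g⟩ ≅ ℤ_{rnt}, and by the Chinese remainder theorem ⟨g⟩ is transitive on
-- ℤ_{rn} × ℤ_t.  An edge of E₁ joins k to k + r; writing k = c + r i with c < r it joins
-- (c , i) to (c , i + 1), so [E₁] consists of r disjoint n-cycles with every edge
-- repeated t times, which for n = 2 are r bundles of 2t parallel edges.

open import Defs
open import Data.Nat using (ℕ; zero; suc; _+_; _*_; _∸_; _≤_; _<_; z<s; NonZero; _%_)
open import Data.Nat.Properties using (+-assoc; +-comm; *-comm; *-identityˡ; *-identityʳ; <⇒≤; <⇒≱; m+[n∸m]≡n)
open import Data.Nat.DivMod
open import Data.Nat.Divisibility using (_∣_; divides; _∣0; ∣-trans; ∣⇒≤; m∣m*n; n∣m*n; m%n≡0⇒n∣m)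
open import Data.Nat.Coprimality using (Coprime; coprime-Bézout; coprime⇒gcd≡1; gcd≡1⇒coprime)
import Data.Nat.Coprimality as Coprime
open import Data.Nat.GCD using (gcd; module Bézout)
open import Data.Nat.LCM using (lcm; lcm-least; gcd*lcm)
open import Data.Nat.GeneralisedArithmetic using (iterate)
open import Data.Nat.Solver using (module +-*-Solver)
open import Data.Fin using (Fin; toℕ; cast; combine; remQuot) renaming (zero to fzero; suc to fsuc)
open import Data.Fin.Properties
  using (toℕ-injective; toℕ-fromℕ<; toℕ<n; toℕ-cast; toℕ-combine; cast-involutive; *↔×; remQuot-combine; combine-remQuot)
open import Data.Product as Prod using (∃; Σ; _×_; _,_; proj₁; proj₂; uncurry; assocʳ′; assocˡ′)
open import Data.Product.Algebra using (×-comm)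
open import Data.Sum as Sum using (_⊎_; inj₁; inj₂)
open import Data.Sum.Properties using (inj₁-injective; inj₂-injective)
open import Data.Unit using (⊤; tt)
open import Relation.Nullary using (¬_)
open import Relation.Binary.PropositionalEquality
open import Relation.Binary.Construct.Closure.ReflexiveTransitive using (ε; _◅_)
open import Function.Base using (_∘_; id; _∋_)
open import Function.Definitions using (Bijective; Injective)
open import Function.Bundles using (_↔_; _⇔_; mk⇔; mk↔ₛ′; Inverse; Bijection)
open import Function.Properties.Inverse using (↔-sym; ↔-trans; ↔⇒⤖)
open import Function.Construct.Identity using (⇔-id)

open +-*-Solver

%-absorbˡ-+ : ∀ a b n .{{_ : NonZero n}} → (a % n + b) % n ≡ (a + b) % n
%-absorbˡ-+ a b n = begin
  (a % n + b) % n           ≡⟨ %-distribˡ-+ (a % n) b n ⟩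
  (a % n % n + b % n) % n   ≡⟨ cong (λ x → (x + b % n) % n) (m%n%n≡m%n a n) ⟩
  (a % n + b % n) % n       ≡⟨ %-distribˡ-+ a b n ⟨
  (a + b) % n               ∎
  where open ≡-Reasoning

*-%-unit : ∀ a e n .{{_ : NonZero n}} → e % n ≡ 1 % n → (a * e) % n ≡ a % n
*-%-unit a e n e≡1 = begin
  (a * e) % n               ≡⟨ %-distribˡ-* a e n ⟩
  (a % n * (e % n)) % n     ≡⟨ cong (λ x → (a % n * x) % n) e≡1 ⟩
  (a % n * (1 % n)) % n     ≡⟨ %-distribˡ-* a 1 n ⟨
  (a * 1) % n               ≡⟨ cong (_% n) (*-identityʳ a) ⟩
  a % n                     ∎
  where open ≡-Reasoning

coprime⇒*∣ : ∀ {m n c} → Coprime m n → m ∣ c → n ∣ c → m * n ∣ c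
coprime⇒*∣ {m} {n} m⊥n m∣c n∣c = subst (_∣ _) lcm≡* (lcm-least m∣c n∣c)
  where
  lcm≡* : lcm m n ≡ m * n
  lcm≡* = trans (sym (*-identityˡ (lcm m n)))
                (trans (cong (_* lcm m n) (sym (coprime⇒gcd≡1 m⊥n))) (gcd*lcm m n))

coprime-idempotent : ∀ {m n} → Coprime (suc m) n →
                     ∃ λ e → e % suc m ≡ 1 % suc m × n ∣ e
coprime-idempotent {m} {n} m⊥n with coprime-Bézout m⊥n
... | Bézout.-+ x y 1+xm≡yn = y * n ,
  (begin
    (y * n) % suc m               ≡⟨ cong (_% suc m) 1+xm≡yn ⟨
    (1 + x * suc m) % suc m       ≡⟨ [m+kn]%n≡m%n 1 x (suc m) ⟩
    1 % suc m                     ∎) ,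
  divides y refl
  where open ≡-Reasoning
... | Bézout.+- x y 1+yn≡xm = y * n * m ,
  -- here y n ≡ -1 modulo m + 1, so y n m ≡ 1
  (begin
    (y * n * m) % suc m                       ≡⟨ [m+kn]%n≡m%n (y * n * m) x (suc m) ⟨
    (y * n * m + x * suc m) % suc m           ≡⟨ cong (λ z → (y * n * m + z) % suc m) 1+yn≡xm ⟨
    (y * n * m + (1 + y * n)) % suc m         ≡⟨ cong (_% suc m) (solve 3 (λ y n m →
                                                   y :* n :* m :+ (con 1 :+ y :* n) := con 1 :+ (y :* n) :* (con 1 :+ m))
                                                 refl y n m) ⟩
    (1 + (y * n) * suc m) % suc m             ≡⟨ [m+kn]%n≡m%n 1 (y * n) (suc m) ⟩
    1 % suc m                                 ∎) ,
  divides (y * m) (solve 3 (λ y n m → y :* n :* m := y :* m :* n) refl y n m)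
  where open ≡-Reasoning

chinese-remainder : ∀ {m n} → Coprime (suc m) (suc n) → ∀ a b →
                    ∃ λ x → x % suc m ≡ a % suc m × x % suc n ≡ b % suc n
chinese-remainder {m} {n} m⊥n a b with coprime-idempotent m⊥n | coprime-idempotent (Coprime.sym m⊥n)
... | e , e≡1 , n∣e | f , f≡1 , m∣f = a * e + b * f ,
  trans (%-remove-+ʳ (a * e) (∣-trans m∣f (n∣m*n b))) (*-%-unit a e (suc m) e≡1) ,
  trans (%-remove-+ˡ (b * f) (∣-trans n∣e (n∣m*n a))) (*-%-unit b f (suc n) f≡1)

inj₁≢inj₂ : ∀ {A B : Set} {a : A} {b : B} → inj₁ a ≢ inj₂ b
inj₁≢inj₂ ()

↔-bijective : ∀ {A B : Set} (i : A ↔ B) → Bijective _≡_ _≡_ (Inverse.to i)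
↔-bijective i = Bijection.bijective (↔⇒⤖ i)

iterate-natural : ∀ {A B : Set} {f : A → A} {g : B → B} (h : A → B) →
                  (∀ a → g (h a) ≡ h (f a)) → ∀ a k → iterate g (h a) k ≡ h (iterate f a k)
iterate-natural h g∘h≡h∘f a zero    = refl
iterate-natural {g = g} h g∘h≡h∘f a (suc k) =
  trans (cong (λ b → iterate g b k) (g∘h≡h∘f a)) (iterate-natural h g∘h≡h∘f _ k)

iterate-map-× : ∀ {A B : Set} (f : A → A) (g : B → B) a b k →
                iterate (Prod.map f g) (a , b) k ≡ (iterate f a k , iterate g b k)
iterate-map-× f g a b zero    = refl
iterate-map-× f g a b (suc k) = iterate-map-× f g (f a) (g b) k

periodic⇒bijective : ∀ {A : Set} {f : A → A} k → PowId f k → 0 < k → Bijective _≡_ _≡_ f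
periodic⇒bijective {f = f} (suc k) period _ = ↔-bijective (mk↔ₛ′ f (λ x → iterate f x k) f∘f⁻¹ period)
  where
  f∘f⁻¹ : ∀ x → f (iterate f x k) ≡ x
  f∘f⁻¹ x = trans (sym (iterate-natural f (λ _ → refl) x k)) (period x)

hasOrder-coprime : ∀ {A : Set} {f : A → A} {m n} → Coprime m n → PowId f (m * n) →
                   (∀ k → PowId f k → m ∣ k × n ∣ k) → HasOrder f (m * n)
hasOrder-coprime {f = f} {m} {n} m⊥n period powId⇒∣ = period , minimal
  where
  minimal : ∀ k → 0 < k → k < m * n → ¬ PowId f k
  minimal (suc k) _ k<mn pow = <⇒≱ k<mn (∣⇒≤ (uncurry (coprime⇒*∣ m⊥n) (powId⇒∣ (suc k) pow)))

module _ {m : ℕ} where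

  private
    M : ℕ
    M = suc m

  toℕ-shift : ∀ k (i : Fin M) → toℕ (shift k i) ≡ (toℕ i + k) % M
  toℕ-shift k i = toℕ-fromℕ< _

  shift-cong : ∀ {k l} → k % M ≡ l % M → (i : Fin M) → shift k i ≡ shift l i
  shift-cong {k} {l} k≡l i = toℕ-injective (begin
    toℕ (shift k i)          ≡⟨ toℕ-shift k i ⟩
    (toℕ i + k) % M          ≡⟨ %-distribˡ-+ (toℕ i) k M ⟩
    (toℕ i % M + k % M) % M  ≡⟨ cong (λ x → (toℕ i % M + x) % M) k≡l ⟩
    (toℕ i % M + l % M) % M  ≡⟨ %-distribˡ-+ (toℕ i) l M ⟨
    (toℕ i + l) % M          ≡⟨ toℕ-shift l i ⟨
    toℕ (shift l i)          ∎)
    where open ≡-Reasoning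

  shift-multiple : ∀ {k} → M ∣ k → (i : Fin M) → shift k i ≡ i
  shift-multiple (divides q refl) i = toℕ-injective (begin
    toℕ (shift (q * M) i)    ≡⟨ toℕ-shift (q * M) i ⟩
    (toℕ i + q * M) % M      ≡⟨ [m+kn]%n≡m%n (toℕ i) q M ⟩
    toℕ i % M                ≡⟨ m<n⇒m%n≡m (toℕ<n i) ⟩
    toℕ i                    ∎)
    where open ≡-Reasoning

  shift-+ : ∀ k l (i : Fin M) → shift k (shift l i) ≡ shift (l + k) i
  shift-+ k l i = toℕ-injective (begin
    toℕ (shift k (shift l i))  ≡⟨ toℕ-shift k (shift l i) ⟩
    (toℕ (shift l i) + k) % M  ≡⟨ cong (λ x → (x + k) % M) (toℕ-shift l i) ⟩
    ((toℕ i + l) % M + k) % M  ≡⟨ %-absorbˡ-+ (toℕ i + l) k M ⟩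
    (toℕ i + l + k) % M        ≡⟨ cong (_% M) (+-assoc (toℕ i) l k) ⟩
    (toℕ i + (l + k)) % M      ≡⟨ toℕ-shift (l + k) i ⟨
    toℕ (shift (l + k) i)      ∎)
    where open ≡-Reasoning

  shift-comm : ∀ k l (i : Fin M) → shift k (shift l i) ≡ shift l (shift k i)
  shift-comm k l i =
    trans (shift-+ k l i) (trans (cong (λ x → shift x i) (+-comm l k)) (sym (shift-+ l k i)))

  iterate-shift₁ : ∀ (i : Fin M) k → iterate (shift 1) i k ≡ shift k i
  iterate-shift₁ i zero    = sym (shift-multiple (M ∣0) i)
  iterate-shift₁ i (suc k) = trans (iterate-shift₁ (shift 1 i) k) (shift-+ k 1 i)

  shift-fixes-zero⇒∣ : ∀ k → shift k (fzero {m}) ≡ fzero → M ∣ k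
  shift-fixes-zero⇒∣ k eq = m%n≡0⇒n∣m k M (trans (sym (toℕ-shift k fzero)) (cong toℕ eq))

  shift-transitive : (i j : Fin M) → ∃ λ k → shift k i ≡ j
  shift-transitive i j = M ∸ toℕ i + toℕ j , toℕ-injective (begin
    toℕ (shift (M ∸ toℕ i + toℕ j) i)  ≡⟨ toℕ-shift _ i ⟩
    (toℕ i + (M ∸ toℕ i + toℕ j)) % M  ≡⟨ cong (_% M) (+-assoc (toℕ i) (M ∸ toℕ i) (toℕ j)) ⟨
    (toℕ i + (M ∸ toℕ i) + toℕ j) % M  ≡⟨ cong (λ x → (x + toℕ j) % M) (m+[n∸m]≡n (<⇒≤ (toℕ<n i))) ⟩
    (M + toℕ j) % M                    ≡⟨ cong (_% M) (+-comm M (toℕ j)) ⟩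
    (toℕ j + M) % M                    ≡⟨ [m+n]%n≡m%n (toℕ j) M ⟩
    toℕ j % M                          ≡⟨ m<n⇒m%n≡m (toℕ<n j) ⟩
    toℕ j                              ∎)
    where open ≡-Reasoning

iterate-shift₁² : ∀ {m n} (k : Fin (suc m)) (j : Fin (suc n)) x →
                  iterate (Prod.map (shift 1) (shift 1)) (k , j) x ≡ (shift x k , shift x j)
iterate-shift₁² k j x = trans (iterate-map-× (shift 1) (shift 1) k j x)
                              (cong₂ _,_ (iterate-shift₁ k x) (iterate-shift₁ j x))

shift-transitive² : ∀ {m n} → Coprime (suc m) (suc n) → (i i′ : Fin (suc m)) (j j′ : Fin (suc n)) →
                    ∃ λ k → shift k i ≡ i′ × shift k j ≡ j′
shift-transitive² m⊥n i i′ j j′ with shift-transitive i i′ | shift-transitive j j′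
... | k₁ , i→i′ | k₂ , j→j′ with chinese-remainder m⊥n k₁ k₂
... | k , k≡k₁ , k≡k₂ = k , trans (shift-cong k≡k₁ i) i→i′ , trans (shift-cong k≡k₂ j) j→j′

cast-↔ : ∀ {m n} → m ≡ n → Fin m ↔ Fin n
cast-↔ eq = mk↔ₛ′ (cast eq) (cast (sym eq)) (cast-involutive eq (sym eq)) (cast-involutive (sym eq) eq)

-- k = c + r i: c is the residue of k modulo r, i its position in the coset c + ⟨r⟩.
cosets-↔ : ∀ {r n} → (Fin r × Fin n) ↔ Fin (r * n)
cosets-↔ {r} {n} = ↔-trans (×-comm _ _) (↔-trans (↔-sym (*↔× {n} {r})) (cast-↔ (*-comm n r)))

coset : ∀ {r n} → Fin r × Fin n → Fin (r * n)
coset = Inverse.to cosets-↔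

toℕ-coset : ∀ {r n} (c : Fin r) (i : Fin n) → toℕ (coset (c , i)) ≡ toℕ i * r + toℕ c
toℕ-coset {r} {n} c i =
  trans (toℕ-cast _ (combine i c)) (trans (toℕ-combine i c) (cong (_+ toℕ c) (*-comm r (toℕ i))))

next : ∀ {r n} → Fin r × Fin (suc n) → Fin r × Fin (suc n)
next = Prod.map₂ (shift 1)

shift-coset : ∀ {r n} (w : Fin (suc r) × Fin (suc n)) → shift (suc r) (coset w) ≡ coset (next w)
shift-coset {r} {n} (c , i) = toℕ-injective (begin
  toℕ (shift R (coset (c , i)))        ≡⟨ toℕ-shift R (coset (c , i)) ⟩
  (toℕ (coset (c , i)) + R) % (R * N)  ≡⟨ cong (λ x → (x + R) % (R * N)) (toℕ-coset c i) ⟩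
  (toℕ i * R + toℕ c + R) % (R * N)    ≡⟨ cong (_% (R * N)) (solve 3 (λ i c r → i :* r :+ c :+ r := (i :+ con 1) :* r :+ c)
                                                                    refl (toℕ i) (toℕ c) R) ⟩
  ((toℕ i + 1) * R + toℕ c) % (R * N)  ≡⟨ %-congʳ {o = (toℕ i + 1) * R + toℕ c} (*-comm R N) ⟩
  ((toℕ i + 1) * R + toℕ c) % (N * R)  ≡⟨ [m*n+o]%[p*n]≡[m*n]%[p*n]+o (toℕ i + 1) N (toℕ<n c) ⟩
  (toℕ i + 1) * R % (N * R) + toℕ c    ≡⟨ cong (_+ toℕ c) (m%n*o≡m*o%[n*o] (toℕ i + 1) N R) ⟨
  (toℕ i + 1) % N * R + toℕ c          ≡⟨ cong (λ x → x * R + toℕ c) (toℕ-shift 1 i) ⟨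
  toℕ (shift 1 i) * R + toℕ c          ≡⟨ toℕ-coset c (shift 1 i) ⟨
  toℕ (coset (c , shift 1 i))          ∎)
  where
  open ≡-Reasoning
  R N : ℕ
  R = suc r
  N = suc n

incident-image : ∀ {G H : Graph} {φ : Vtx G → Vtx H} → Injective _≡_ _≡_ φ → ∀ e e′ →
                 (ends H e′ ≡ Prod.map φ φ (ends G e)) ⊎ (ends H e′ ≡ Prod.swap (Prod.map φ φ (ends G e))) →
                 ∀ v → Incident G e v ⇔ Incident H e′ (φ v)
incident-image {G} {H} {φ} φ-inj e e′ = image (ends G e) (ends H e′)
  where
  image : ∀ p q → (q ≡ Prod.map φ φ p) ⊎ (q ≡ Prod.swap (Prod.map φ φ p)) →
          ∀ v → (v ≡ proj₁ p ⊎ v ≡ proj₂ p) ⇔ (φ v ≡ proj₁ q ⊎ φ v ≡ proj₂ q)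
  image p _ (inj₁ refl) v = mk⇔ (Sum.map (cong φ) (cong φ)) (Sum.map φ-inj φ-inj)
  image p _ (inj₂ refl) v = mk⇔ (Sum.swap ∘ Sum.map (cong φ) (cong φ)) (Sum.map φ-inj φ-inj ∘ Sum.swap)

Γ-connected : ∀ {r n t} → Fin (r * n) → Fin t → Connected (Γ r n t)
Γ-connected k₀ j₀ (inj₁ k) (inj₂ j)  = (inj₁ (k , j) , inj₁ refl) ◅ ε
Γ-connected k₀ j₀ (inj₂ j) (inj₁ k)  = (inj₁ (k , j) , inj₂ refl) ◅ ε
Γ-connected k₀ j₀ (inj₁ k) (inj₁ k′) = (inj₁ (k , j₀) , inj₁ refl) ◅ (inj₁ (k′ , j₀) , inj₂ refl) ◅ ε
Γ-connected k₀ j₀ (inj₂ j) (inj₂ j′) = (inj₁ (k₀ , j) , inj₂ refl) ◅ (inj₁ (k₀ , j′) , inj₁ refl) ◅ ε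

[E₀]≅Kbip : ∀ {r n t} → Fin (r * n) → Fin t → InducedIso (Γ r n t) (InE₀ r n t) (Kbip (r * n) t)
[E₀]≅Kbip {r} {n} {t} k₀ j₀ = id , Inverse.to E₀-edges , id , vertices , ↔-bijective E₀-edges , λ _ _ → ⇔-id _
  where
  E₀-edges : (Fin (r * n) × Fin t) ↔ Σ (GE r n t) (InE₀ r n t)
  E₀-edges = mk↔ₛ′ (λ p → inj₁ p , tt) (λ { (inj₁ p , _) → p ; (inj₂ _ , ()) })
                   (λ { (inj₁ p , tt) → refl ; (inj₂ _ , ()) }) (λ _ → refl)
  vertices : ∀ v → (∃ λ e → InE₀ r n t e × Incident (Γ r n t) e v) ⇔ (∃ λ w → w ≡ v)
  vertices v = mk⇔ (λ _ → v , refl) (λ _ → incident v)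
    where
    incident : ∀ v → ∃ λ e → InE₀ r n t e × Incident (Γ r n t) e v
    incident (inj₁ k) = inj₁ (k , j₀) , tt , inj₁ refl
    incident (inj₂ j) = inj₁ (k₀ , j) , tt , inj₂ refl

E₁-edges : ∀ {r n t} → ((Fin r × Fin n) × Fin t) ↔ Σ (GE r n t) (InE₁ r n t)
E₁-edges {r} {n} {t} = mk↔ₛ′ (λ (w , l) → inj₂ (coset w , l) , tt) from′ to∘from from∘to
  where
  open Inverse (cosets-↔ {r} {n})
  from′ : Σ (GE r n t) (InE₁ r n t) → (Fin r × Fin n) × Fin t
  from′ (inj₂ (k , l) , _) = from k , l
  to∘from : ∀ e → (inj₂ (coset (proj₁ (from′ e)) , proj₂ (from′ e)) , tt) ≡ e
  to∘from (inj₂ (k , l) , tt) = cong (λ k → inj₂ (k , l) , tt) (strictlyInverseˡ k)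
  from∘to : ∀ p → from′ (inj₂ (coset (proj₁ p) , proj₂ p) , tt) ≡ p
  from∘to (w , l) = cong (_, l) (strictlyInverseʳ w)

[E₁]-vertices : ∀ {r n t} → Fin t → ∀ v →
                (∃ λ e → InE₁ r n t e × Incident (Γ r n t) e v) ⇔ (∃ λ (w : Fin r × Fin n) → inj₁ (coset w) ≡ v)
[E₁]-vertices {r} {n} {t} j₀ v = mk⇔ vertex (λ (w , eq) → inj₂ (coset w , j₀) , tt , inj₁ (sym eq))
  where
  open Inverse (cosets-↔ {r} {n})
  vertex : (∃ λ e → InE₁ r n t e × Incident (Γ r n t) e v) → ∃ λ (w : Fin r × Fin n) → inj₁ (coset w) ≡ v
  vertex (inj₂ (k , _) , _ , inj₁ refl) = from k , cong inj₁ (strictlyInverseˡ k)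
  vertex (inj₂ (k , _) , _ , inj₂ refl) = from (shift r k) , cong inj₁ (strictlyInverseˡ (shift r k))

module _ (r n t : ℕ) where

  private
    R N T M : ℕ
    R = suc r
    N = suc n
    T = suc t
    M = R * N

  gV-iterate₁ : ∀ k x → iterate (gV R N T) (inj₁ k) x ≡ inj₁ (shift x k)
  gV-iterate₁ k x = trans (iterate-natural inj₁ (λ _ → refl) k x) (cong inj₁ (iterate-shift₁ k x))

  gV-iterate₂ : ∀ j x → iterate (gV R N T) (inj₂ j) x ≡ inj₂ (shift x j)
  gV-iterate₂ j x = trans (iterate-natural inj₂ (λ _ → refl) j x) (cong inj₂ (iterate-shift₁ j x))

  gE-iterate₁ : ∀ k j x → iterate (gE R N T) (inj₁ (k , j)) x ≡ inj₁ (shift x k , shift x j)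
  gE-iterate₁ k j x = trans (iterate-natural inj₁ (λ _ → refl) (k , j) x) (cong inj₁ (iterate-shift₁² k j x))

  gE-iterate₂ : ∀ k j x → iterate (gE R N T) (inj₂ (k , j)) x ≡ inj₂ (shift x k , shift x j)
  gE-iterate₂ k j x = trans (iterate-natural inj₂ (λ _ → refl) (k , j) x) (cong inj₂ (iterate-shift₁² k j x))

  gV-period : PowId (gV R N T) (M * T)
  gV-period (inj₁ k) = trans (gV-iterate₁ k (M * T)) (cong inj₁ (shift-multiple (m∣m*n T) k))
  gV-period (inj₂ j) = trans (gV-iterate₂ j (M * T)) (cong inj₂ (shift-multiple (n∣m*n M) j))

  gE-period : PowId (gE R N T) (M * T)
  gE-period (inj₁ (k , j)) = trans (gE-iterate₁ k j (M * T))
    (cong inj₁ (cong₂ _,_ (shift-multiple (m∣m*n T) k) (shift-multiple (n∣m*n M) j)))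
  gE-period (inj₂ (k , j)) = trans (gE-iterate₂ k j (M * T))
    (cong inj₂ (cong₂ _,_ (shift-multiple (m∣m*n T) k) (shift-multiple (n∣m*n M) j)))

  gV-powId⇒∣ : ∀ x → PowId (gV R N T) x → M ∣ x × T ∣ x
  gV-powId⇒∣ x pow =
    shift-fixes-zero⇒∣ x (inj₁-injective (trans (sym (gV-iterate₁ fzero x)) (pow (inj₁ fzero)))) ,
    shift-fixes-zero⇒∣ x (inj₂-injective (trans (sym (gV-iterate₂ fzero x)) (pow (inj₂ fzero))))

  gE-powId⇒∣ : ∀ x → PowId (gE R N T) x → M ∣ x × T ∣ x
  gE-powId⇒∣ x pow = shift-fixes-zero⇒∣ x (cong proj₁ fixed) , shift-fixes-zero⇒∣ x (cong proj₂ fixed)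
    where
    fixed : (shift x fzero , shift x fzero) ≡ (Fin M × Fin T ∋ (fzero , fzero))
    fixed = inj₁-injective (trans (sym (gE-iterate₁ fzero fzero x)) (pow (inj₁ (fzero , fzero))))

  g-preserves-ends : ∀ e → ends (Γ R N T) (gE R N T e) ≡ Prod.map (gV R N T) (gV R N T) (ends (Γ R N T) e)
  g-preserves-ends (inj₁ _)       = refl
  g-preserves-ends (inj₂ (k , _)) = cong (λ x → inj₁ (shift 1 k) , inj₁ x) (shift-comm R 1 k)

  g-isAut : IsAut (Γ R N T) (gV R N T) (gE R N T)
  g-isAut = gV-bijective , periodic⇒bijective (M * T) gE-period z<s ,
            λ e → incident-image {G = Γ R N T} {H = Γ R N T} (proj₁ gV-bijective) e (gE R N T e)
                                 (inj₁ (g-preserves-ends e))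
    where
    gV-bijective : Bijective _≡_ _≡_ (gV R N T)
    gV-bijective = periodic⇒bijective (M * T) gV-period z<s

  g-hasOrder : Coprime M T → HasOrder₂ (gV R N T) (gE R N T) (M * T)
  g-hasOrder M⊥T = (gV-period , gE-period) , λ k 0<k k<MT (powV , _) →
    proj₂ (hasOrder-coprime M⊥T gV-period gV-powId⇒∣) k 0<k k<MT powV

  gV-orbits : SumOrbits (gV R N T)
  gV-orbits = reach₁ , reach₂ , apart₁ , apart₂
    where
    reach₁ : ∀ k k′ → Orbit (gV R N T) (inj₁ k) (inj₁ k′)
    reach₁ k k′ = let x , k→k′ = shift-transitive k k′ in x , trans (gV-iterate₁ k x) (cong inj₁ k→k′)
    reach₂ : ∀ j j′ → Orbit (gV R N T) (inj₂ j) (inj₂ j′)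
    reach₂ j j′ = let x , j→j′ = shift-transitive j j′ in x , trans (gV-iterate₂ j x) (cong inj₂ j→j′)
    apart₁ : ∀ k j → ¬ Orbit (gV R N T) (inj₁ k) (inj₂ j)
    apart₁ k j (x , eq) = inj₁≢inj₂ (trans (sym (gV-iterate₁ k x)) eq)
    apart₂ : ∀ k j → ¬ Orbit (gV R N T) (inj₂ j) (inj₁ k)
    apart₂ k j (x , eq) = inj₁≢inj₂ (trans (sym eq) (gV-iterate₂ j x))

  gE-orbits : Coprime M T → SumOrbits (gE R N T)
  gE-orbits M⊥T = reach₁ , reach₂ , apart₁ , apart₂
    where
    reach₁ : ∀ e e′ → Orbit (gE R N T) (inj₁ e) (inj₁ e′)
    reach₁ (k , j) (k′ , j′) = let x , k→k′ , j→j′ = shift-transitive² M⊥T k k′ j j′ in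
      x , trans (gE-iterate₁ k j x) (cong inj₁ (cong₂ _,_ k→k′ j→j′))
    reach₂ : ∀ e e′ → Orbit (gE R N T) (inj₂ e) (inj₂ e′)
    reach₂ (k , j) (k′ , j′) = let x , k→k′ , j→j′ = shift-transitive² M⊥T k k′ j j′ in
      x , trans (gE-iterate₂ k j x) (cong inj₂ (cong₂ _,_ k→k′ j→j′))
    apart₁ : ∀ e e′ → ¬ Orbit (gE R N T) (inj₁ e) (inj₂ e′)
    apart₁ (k , j) _ (x , eq) = inj₁≢inj₂ (trans (sym (gE-iterate₁ k j x)) eq)
    apart₂ : ∀ e e′ → ¬ Orbit (gE R N T) (inj₂ e′) (inj₁ e)
    apart₂ _ (k , j) (x , eq) = inj₁≢inj₂ (trans (sym eq) (gE-iterate₂ k j x))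

  gE-biRegular : Coprime M T → BiRegular (gE R N T) (M * T)
  gE-biRegular M⊥T = gE-orbits M⊥T , hasOrder-coprime M⊥T gE-period gE-powId⇒∣

  [E₁]≅ : {E : Set} (en : E → (Fin R × Fin N) × (Fin R × Fin N)) (κ : E ↔ ((Fin R × Fin N) × Fin T)) →
          (∀ e → let w = proj₁ (Inverse.to κ e) in en e ≡ (w , next w) ⊎ en e ≡ (next w , w)) →
          InducedIso (Γ R N T) (InE₁ R N T) (record { Vtx = Fin R × Fin N ; Edge = E ; ends = en })
  [E₁]≅ {E} en κ oriented =
    φV , Inverse.to φE , φV-injective , [E₁]-vertices fzero , ↔-bijective φE , incidence
    where
    H : Graph
    H = record { Vtx = Fin R × Fin N ; Edge = E ; ends = en }
    φV : Fin R × Fin N → GV R N T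
    φV = inj₁ ∘ coset
    φE : E ↔ Σ (GE R N T) (InE₁ R N T)
    φE = ↔-trans κ E₁-edges
    φV-injective : Injective _≡_ _≡_ φV
    φV-injective = proj₁ (↔-bijective cosets-↔) ∘ inj₁-injective
    coset-edge-ends : ∀ w l → ends (Γ R N T) (inj₂ (coset w , l)) ≡ Prod.map φV φV (w , next w)
    coset-edge-ends w l = cong (λ k → inj₁ (coset w) , inj₁ k) (shift-coset w)
    incidence : ∀ e w → Incident H e w ⇔ Incident (Γ R N T) (proj₁ (Inverse.to φE e)) (φV w)
    incidence e = incident-image {G = H} {H = Γ R N T} φV-injective e (proj₁ (Inverse.to φE e))
      (Sum.map (λ eq → trans (coset-edge-ends w l) (cong (Prod.map φV φV) (sym eq)))
               (λ eq → trans (coset-edge-ends w l) (cong (Prod.swap ∘ Prod.map φV φV) (sym eq)))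
               (oriented e))
      where
      w : Fin R × Fin N
      w = proj₁ (Inverse.to κ e)
      l : Fin T
      l = proj₂ (Inverse.to κ e)

  [E₁]≅cycles : InducedIso (Γ R N T) (InE₁ R N T) (copies R (mult T (Cycle N)))
  [E₁]≅cycles = [E₁]≅ _ (mk↔ₛ′ assocˡ′ assocʳ′ (λ _ → refl) (λ _ → refl)) (λ _ → inj₁ refl)

[E₁]≅K₂ : ∀ r t → InducedIso (Γ (suc r) 2 (suc t)) (InE₁ (suc r) 2 (suc t)) (copies (suc r) (mult (2 * suc t) K2))
[E₁]≅K₂ r t = [E₁]≅ r 1 t _ κ (λ (c , _ , l) → oriented c (proj₁ (remQuot (suc t) l)))
  where
  κ : (Fin (suc r) × (⊤ × Fin (2 * suc t))) ↔ ((Fin (suc r) × Fin 2) × Fin (suc t))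
  κ = mk↔ₛ′ (λ (c , _ , l) → Prod.map₁ (c ,_) (remQuot (suc t) l)) (λ ((c , i) , l) → c , tt , combine i l)
            (λ ((c , i) , l) → cong (Prod.map₁ (c ,_)) (remQuot-combine i l))
            (λ (c , _ , l) → cong (λ l → c , tt , l) (combine-remQuot (suc t) l))
  oriented : ∀ c (i : Fin 2) → ((c , fzero) , (c , fsuc fzero)) ≡ ((c , i) , next (c , i))
                             ⊎ ((c , fzero) , (c , fsuc fzero)) ≡ (next (c , i) , (c , i))
  oriented c fzero        = inj₁ refl
  oriented c (fsuc fzero) = inj₂ refl

lemma4p11 : (r n t : ℕ) → 1 ≤ r → 2 ≤ n → 1 ≤ t → gcd (n * r) t ≡ 1 →
    Connected (Γ r n t) ×
    IsAut (Γ r n t) (gV r n t) (gE r n t) ×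
    HasOrder₂ (gV r n t) (gE r n t) (r * n * t) ×
    SumOrbits (gV r n t) ×
    BiRegular (gE r n t) (r * n * t) ×
    InducedIso (Γ r n t) (InE₀ r n t) (Kbip (r * n) t) ×
    (n ≡ 2 → InducedIso (Γ r n t) (InE₁ r n t) (copies r (mult (2 * t) K2))) ×
    (3 ≤ n → InducedIso (Γ r n t) (InE₁ r n t) (copies r (mult t (Cycle n))))
-- The description of [E₁] by cycles holds for every n ≥ 1; n ≥ 2 is only used to exclude n = 0.
lemma4p11 (suc r) (suc n) (suc t) _ _ _ gcd≡1 =
  Γ-connected fzero fzero ,
  g-isAut r n t ,
  g-hasOrder r n t rn⊥t ,
  gV-orbits r n t ,
  gE-biRegular r n t rn⊥t ,
  [E₀]≅Kbip fzero fzero ,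
  (λ { refl → [E₁]≅K₂ r t }) ,
  (λ _ → [E₁]≅cycles r n t)
  where
  rn⊥t : Coprime (suc r * suc n) (suc t)
  rn⊥t = gcd≡1⇒coprime (subst (λ m → gcd m (suc t) ≡ 1) (*-comm (suc n) (suc r)) gcd≡1)
lemma4p11 zero    _       _       () _  _  _
lemma4p11 (suc _) zero    _       _  () _  _
lemma4p11 (suc _) (suc _) zero    _  _  () _
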